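{- Let \((P,\lambda)\) be a marked poset and \(\pi\) a \((P,\lambda)\)-compatible partition of \(P\), with quotient map \(q\colon P\to P/\pi\). Then the map \(q^*\colon\mathcal{O}(P/\pi,\lambda/\pi)\to\mathcal{O}(P,\lambda)\), \(x\mapsto x\circ q\), is injective, and its image is \[F_\pi=\{y\in\mathcal{O}(P,\lambda): y\text{ is constant on the blocks of }\pi\}.\]
   Context: A marked poset \((P,\lambda)\) is a finite poset \(P\) with an induced subposet \(P^*\subseteq P\) of marked elements and an order-preserving map \(\lambda\colon P^*\to\mathbb{R}\). The marked order polyhedron \(\mathcal{O}(P,\lambda)\subseteq\mathbb{R}^P\) is the set of all \(x\in\mathbb{R}^P\) with \(x_p\le x_q\) whenever \(p\le q\) and \(x_a=\lambda(a)\) for \(a\in P^*\). A partition \(\pi\) of \(P\) is \(P\)-compatible if the transitive closure of "\(B\le C\) if \(p\le q\) for some \(p\in B,q\in C\)" is antisymmetric on blocks (giving a poset \(P/\pi\)); it is \((P,\lambda)\)-compatible if moreover \(\lambda(a)\le\lambda(b)\) whenever \(a\in B\cap P^*\), \(b\in C\cap P^*\), \(B\le C\). The quotient marked poset \((P/\pi,\lambda/\pi)\) has marked elements the blocks meeting \(P^*\) and \((\lambda/\pi)(B)=\lambda(a)\) for any \(a\in B\cap P^*\). -}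

module Defs where

open import Level using (Level; 0ℓ) renaming (suc to lsuc)
open import Data.Nat using (ℕ)
open import Data.Fin using (Fin)
open import Data.Product using (Σ; ∃; _×_; _,_)
open import Relation.Binary.PropositionalEquality using (_≡_)
open import Relation.Binary.Structures using (IsPartialOrder; IsTotalOrder)
open import Relation.Binary.Construct.Closure.ReflexiveTransitive using (Star)
open import Relation.Nullary using (¬_)
open import Algebra.Structures using (IsCommutativeRing)

-- Any model of this record is ℝ up to
-- unique isomorphism; the theorem is stated for every such model.

record RealField : Set₁ where
  infixl 6 _+_
  infixl 7 _*_
  infix  4 _≤_
  field
    Carrier : Set
    _+_ _*_ : Carrier → Carrier → Carrier
    -_      : Carrier → Carrier
    0# 1#   : Carrier
    _≤_     : Carrier → Carrier → Set
    isCommutativeRing : IsCommutativeRing _≡_ _+_ _*_ -_ 0# 1#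
    0≢1     : ¬ (0# ≡ 1#)
    inverse : ∀ x → ¬ (x ≡ 0#) → Σ Carrier λ y → x * y ≡ 1#
    isTotalOrder : IsTotalOrder _≡_ _≤_
    +-mono-≤ : ∀ {x y} z → x ≤ y → x + z ≤ y + z
    *-nonneg : ∀ {x y} → 0# ≤ x → 0# ≤ y → 0# ≤ x * y
    lub : (S : Carrier → Set) → Σ Carrier S →
          Σ Carrier (λ b → ∀ s → S s → s ≤ b) →
          Σ Carrier (λ u → (∀ s → S s → s ≤ u) ×
                           (∀ b → (∀ s → S s → s ≤ b) → u ≤ b))

record FinPoset : Set₁ where
  field
    size   : ℕ
    _≤P_   : Fin size → Fin size → Set
    isPartialOrder : IsPartialOrder _≡_ _≤P_

module _ (ℝ : RealField) where
  open RealField ℝ renaming (Carrier to R; _≤_ to _≤ᵣ_)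

  -- A marked poset (P, λ): P* is given by the predicate `marked`
  -- (the induced subposet), λ : P* → ℝ order preserving.
  record MarkedPoset : Set₁ where
    field
      poset  : FinPoset
    open FinPoset poset public
    field
      marked : Fin size → Set
      mark   : (a : Fin size) → marked a → R
      mark-mono : ∀ {a b} (ma : marked a) (mb : marked b) →
                  a ≤P b → mark a ma ≤ᵣ mark b mb

  InOrderPolyhedron : (n : ℕ) (_≤P_ : Fin n → Fin n → Set)
                      (marked : Fin n → Set) (mark : (a : Fin n) → marked a → R) →
                      (Fin n → R) → Set
  InOrderPolyhedron n _≤P_ marked mark x =
    (∀ p q → p ≤P q → x p ≤ᵣ x q) × (∀ a (ma : marked a) → x a ≡ mark a ma)

  module _ (M : MarkedPoset) where
    open MarkedPoset M

    O : (Fin size → R) → Set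
    O = InOrderPolyhedron size _≤P_ marked mark

    -- A partition π of P into k blocks, given by the block map
    -- q : P → Fin k, surjective so that every block is nonempty.
    record Partition : Set where
      field
        k    : ℕ
        blk  : Fin size → Fin k
        surj : ∀ (B : Fin k) → ∃ λ p → blk p ≡ B

    module _ (π : Partition) where
      open Partition π

      _≤₀_ : Fin k → Fin k → Set
      B ≤₀ C = ∃ λ p → ∃ λ p' → blk p ≡ B × blk p' ≡ C × p ≤P p'

      -- the order of P/π: (reflexive-)transitive closure of ≤₀
      -- (≤₀ is already reflexive since blocks are nonempty)
      _≤π_ : Fin k → Fin k → Set
      _≤π_ = Star _≤₀_

      P-compatible : Set
      P-compatible = ∀ B C → B ≤π C → C ≤π B → B ≡ C

      Pλ-compatible : Set
      Pλ-compatible = P-compatible ×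
        (∀ a b (ma : marked a) (mb : marked b) →
           blk a ≤π blk b → mark a ma ≤ᵣ mark b mb)

      markedπ : Fin k → Set
      markedπ B = Σ (Fin size) λ a → marked a × blk a ≡ B

      markπ : (B : Fin k) → markedπ B → R
      markπ B (a , ma , _) = mark a ma

      Oπ : (Fin k → R) → Set
      Oπ = InOrderPolyhedron k _≤π_ markedπ markπ

      q* : (Fin k → R) → (Fin size → R)
      q* x p = x (blk p)

      Fπ : (Fin size → R) → Set
      Fπ y = O y × (∀ p p' → blk p ≡ blk p' → y p ≡ y p')

module Submission where

open import Defs
open import Data.Fin using (Fin)
open import Data.Product using (Σ; _×_; _,_; proj₁; proj₂)
open import Function using (_∘_)
open import Relation.Binary.PropositionalEquality
  using (_≡_; refl; sym; trans; cong; subst₂)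
open import Relation.Binary.Structures using (IsTotalOrder)
open import Relation.Binary.Construct.Closure.ReflexiveTransitive using (ε; _◅_; fold)

-- Pullback along the surjection q : P → P/π identifies functions on P/π with
-- functions on P that are constant on blocks; the inverse reads a block's value
-- off any chosen representative. A function on P/π is monotone for the
-- transitive closure of ≤₀ as soon as it is monotone on single ≤₀-steps, and
-- on such a step monotonicity is exactly that of its pullback on P.
-- Compatibility of π is needed only for P/π to be a poset, not for this.

module QuotientPullback (ℝ : RealField) (M : MarkedPoset ℝ) (π : Partition ℝ M) where
  open RealField ℝ using () renaming (Carrier to R; _≤_ to _≤ᵣ_; isTotalOrder to ≤ᵣ-isTotalOrder)
  open IsTotalOrder ≤ᵣ-isTotalOrder using () renaming (refl to ≤ᵣ-refl; trans to ≤ᵣ-trans)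
  open MarkedPoset M
  open Partition π

  ConstantOnBlocks : (Fin size → R) → Set
  ConstantOnBlocks y = ∀ p p' → blk p ≡ blk p' → y p ≡ y p'

  InImage : (Fin size → R) → Set
  InImage y = Σ (Fin k → R) λ x → Oπ ℝ M π x × (∀ p → q* ℝ M π x p ≡ y p)

  representative : Fin k → Fin size
  representative B = proj₁ (surj B)

  blk-representative : ∀ B → blk (representative B) ≡ B
  blk-representative B = proj₂ (surj B)

  ≤π-monotone : (x : Fin k → R) → (∀ {B C} → _≤₀_ ℝ M π B C → x B ≤ᵣ x C) →
                ∀ B C → _≤π_ ℝ M π B C → x B ≤ᵣ x C
  ≤π-monotone x step _ _ = fold (λ B C → x B ≤ᵣ x C) (λ B≤₀C → ≤ᵣ-trans (step B≤₀C)) ≤ᵣ-refl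

  q*-preserves-O : ∀ x → Oπ ℝ M π x → O ℝ M (q* ℝ M π x)
  q*-preserves-O x (x-mono , x-mark) =
    (λ p p' p≤p' → x-mono (blk p) (blk p') ((p , p' , refl , refl , p≤p') ◅ ε)) ,
    (λ a ma → x-mark (blk a) (a , ma , refl))

  q*-injective : ∀ x x' → (∀ p → q* ℝ M π x p ≡ q* ℝ M π x' p) → ∀ B → x B ≡ x' B
  q*-injective x x' eq B with surj B
  ... | p , refl = eq p

  q*-constantOnBlocks : ∀ x → ConstantOnBlocks (q* ℝ M π x)
  q*-constantOnBlocks x p p' = cong x

  image⊆Fπ : ∀ y → InImage y → Fπ ℝ M π y
  image⊆Fπ y (x , x∈Oπ , x∘q≡y) =
    ( (λ p p' p≤p' → subst₂ _≤ᵣ_ (x∘q≡y p) (x∘q≡y p') (pullback-mono p p' p≤p'))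
    , (λ a ma → trans (sym (x∘q≡y a)) (pullback-mark a ma)) ) ,
    (λ p p' same → trans (sym (x∘q≡y p)) (trans (q*-constantOnBlocks x p p' same) (x∘q≡y p')))
    where
    pullback-mono = proj₁ (q*-preserves-O x x∈Oπ)
    pullback-mark = proj₂ (q*-preserves-O x x∈Oπ)

  module Descend (y : Fin size → R) (y-const : ConstantOnBlocks y) where
    descend : Fin k → R
    descend = y ∘ representative

    q*-descend : ∀ p → q* ℝ M π descend p ≡ y p
    q*-descend p = y-const (representative (blk p)) p (blk-representative (blk p))

    descend-at : ∀ {p B} → blk p ≡ B → descend B ≡ y p
    descend-at {p} {B} blk-p≡B = y-const (representative B) p (trans (blk-representative B) (sym blk-p≡B))

    descend-preserves-O : O ℝ M y → Oπ ℝ M π descend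
    descend-preserves-O (y-mono , y-mark) =
      ≤π-monotone descend step ,
      λ { B (a , ma , blk-a≡B) → trans (descend-at blk-a≡B) (y-mark a ma) }
      where
      step : ∀ {B C} → _≤₀_ ℝ M π B C → descend B ≤ᵣ descend C
      step (p , p' , blk-p≡B , blk-p'≡C , p≤p') =
        subst₂ _≤ᵣ_ (sym (descend-at blk-p≡B)) (sym (descend-at blk-p'≡C)) (y-mono p p' p≤p')

  Fπ⊆image : ∀ y → Fπ ℝ M π y → InImage y
  Fπ⊆image y (y∈O , y-const) = descend , descend-preserves-O y∈O , q*-descend
    where open Descend y y-const

proposition3p12 : (ℝ : RealField) (M : MarkedPoset ℝ) (π : Partition ℝ M) →
    Pλ-compatible ℝ M π →
    (∀ x → Oπ ℝ M π x → O ℝ M (q* ℝ M π x)) ×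
    (∀ x x' → Oπ ℝ M π x → Oπ ℝ M π x' →
       (∀ p → q* ℝ M π x p ≡ q* ℝ M π x' p) →
       ∀ B → x B ≡ x' B) ×
    (∀ y → (Σ (Fin (Partition.k π) → RealField.Carrier ℝ) λ x →
              Oπ ℝ M π x × (∀ p → q* ℝ M π x p ≡ y p))
           → Fπ ℝ M π y) ×
    (∀ y → Fπ ℝ M π y →
       Σ (Fin (Partition.k π) → RealField.Carrier ℝ) λ x →
         Oπ ℝ M π x × (∀ p → q* ℝ M π x p ≡ y p))
proposition3p12 ℝ M π _ =
  q*-preserves-O ,
  (λ x x' _ _ → q*-injective x x') ,
  image⊆Fπ ,
  Fπ⊆image
  where open QuotientPullback ℝ M π
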